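{- Let $k \geq 3$ be an integer and let $G_k$ be the graph with vertex set $\{a_i, b_i, c_i : 1 \leq i \leq k\}$ (all indices taken modulo $k$) and edge set $\{a_ib_{i-1},\ a_ib_i,\ a_ic_{i-1},\ a_ic_i,\ c_ic_{i+1} : 1 \leq i \leq k\}$. Then $G_k$ is $k$-$\gamma$-vertex critical, $K_{1,4}$-free, contains $K_{1,3}$ as an induced subgraph, and is non-Hamiltonian.
   Context: Equivalently, $G_k$ is obtained from the cycle $b_1b_2\cdots b_kb_1$ by subdividing each edge $b_ib_{i+1}$ with a new vertex $a_{i+1}$ (and $b_kb_1$ with $a_1$), joining consecutive $a_i$'s into a cycle, subdividing each edge $a_ia_{i+1}$ (and $a_ka_1$) with a new vertex $c_i$ (resp. $c_k$), and joining consecutive $c_i$'s into a cycle. $\gamma(G)$ denotes the domination number (minimum size of a set $D$ such that every vertex outside $D$ has a neighbor in $D$). A graph $G$ is $k$-$\gamma$-vertex critical if $\gamma(G)=k$ and $\gamma(G-v)<k$ for every vertex $v$ of $G$. A graph is $H$-free if it contains no induced subgraph isomorphic to $H$; $K_{1,3}$ is the claw. A graph is Hamiltonian if it has a cycle through all its vertices. -}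

module Defs where

open import Data.Nat using (ℕ; zero; suc; _≤_; _<_; NonZero)
open import Data.Nat.DivMod using (_mod_)
open import Data.Fin using (Fin; toℕ)
open import Data.Product using (Σ; ∃; _×_; _,_)
open import Data.Sum using (_⊎_)
open import Data.Empty using (⊥)
open import Data.Unit using (⊤)
open import Data.List using (List; length)
open import Data.List.Relation.Unary.All using (All)
open import Data.List.Membership.Propositional using (_∈_; _∉_)
open import Relation.Nullary using (¬_)
open import Relation.Binary.PropositionalEquality using (_≡_; _≢_)
open import Function.Definitions using (Injective)

-- Generic graph notions.  A graph is a vertex type V with an adjacency
-- relation Adj (assumed symmetric and irreflexive by the instances).

csuc : {k : ℕ} → Fin k → Fin k
csuc {suc n} i = suc (toℕ i) mod suc n

Dominates : {V : Set} → (V → V → Set) → (V → Set) → List V → Set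
Dominates {V} Adj P D =
  All P D × ((u : V) → P u → u ∉ D → ∃ λ w → w ∈ D × Adj u w)

DomNumberIs : {V : Set} → (V → V → Set) → (V → Set) → ℕ → Set
DomNumberIs {V} Adj P m =
  (∃ λ (D : List V) → Dominates Adj P D × length D ≡ m)
  × ((D : List V) → Dominates Adj P D → m ≤ length D)

AllV : {V : Set} → V → Set
AllV _ = ⊤

DomNumberBelow : {V : Set} → (V → V → Set) → (V → Set) → ℕ → Set
DomNumberBelow {V} Adj P m =
  ∃ λ (D : List V) → Dominates Adj P D × length D < m

VertexCritical : {V : Set} → (V → V → Set) → ℕ → Set
VertexCritical {V} Adj m =
  DomNumberIs Adj AllV m
  × ((v : V) → DomNumberBelow Adj (λ u → u ≢ v) m)

InducedStar : {V : Set} → (V → V → Set) → ℕ → Set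
InducedStar {V} Adj m =
  Σ V λ x → Σ (Fin m → V) λ f →
    Injective _≡_ _≡_ f
    × ((i : Fin m) → f i ≢ x)
    × ((i : Fin m) → Adj x (f i))
    × ((i j : Fin m) → i ≢ j → ¬ Adj (f i) (f j))

Hamiltonian : {V : Set} → (V → V → Set) → Set
Hamiltonian {V} Adj =
  Σ ℕ λ n → Σ (Fin n → V) λ f →
    3 ≤ n
    × Injective _≡_ _≡_ f
    × ((v : V) → ∃ λ i → f i ≡ v)
    × ((i : Fin n) → Adj (f i) (f (csuc i)))

-- The graph G_k.  Indices are 0-based elements of Fin k (mod k).

data Kind : Set where
  a b c : Kind

GV : ℕ → Set
GV k = Kind × Fin k

-- one orientation of each edge:
--   a_i b_{i-1}, a_i b_i, a_i c_{i-1}, a_i c_i, c_i c_{i+1}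
GE : (k : ℕ) → GV k → GV k → Set
GE k (a , i) (b , j) = (j ≡ i) ⊎ (csuc j ≡ i)
GE k (a , i) (c , j) = (j ≡ i) ⊎ (csuc j ≡ i)
GE k (c , i) (c , j) = j ≡ csuc i
GE k _ _ = ⊥

GAdj : (k : ℕ) → GV k → GV k → Set
GAdj k u v = GE k u v ⊎ GE k v u

module Submission where

-- G_k consists of an outer cycle of b-vertices subdivided by the a-vertices,
-- and an inner cycle c_0 … c_{k-1} in which consecutive c's share the
-- neighbour a_{i+1}.
--
-- The a-vertices dominate.  Conversely, to every index i we
--   charge the first of a_i, c_{i-1}, b_i, c_i, b_{i-1} lying in a dominating
--   set D (one exists since a_i is dominated); two indices charged the same
--   vertex would leave some b_j or c_j undominated, so |D| ≥ k.
-- * Criticality.  G_k - a_i is dominated by the other k-1 a-vertices, and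
--   G_k - b_i (resp. G_k - c_i) by c_i (resp. b_i) together with the k-2
--   a-vertices other than a_i, a_{i+1}.
-- * Every neighbourhood is covered by three cliques, so there is no induced
--   K_{1,4}; the neighbours b_{i+1}, b_i, c_{i+1} of a_{i+1} form a claw.
-- * b_i has only the neighbours a_i, a_{i+1}, so on a Hamiltonian cycle every
--   a-vertex lies between two b-vertices; then no a-vertex is next to a
--   c-vertex, the c-vertices are closed under the cyclic order of the cycle,
--   and the cycle could contain no b-vertex.

open import Defs
open import Data.Nat using (ℕ; zero; suc; _≤_; _<_; s≤s)
open import Data.Nat.Properties using (<⇒≤; n<1+n; ≤-trans)
open import Data.Nat.DivMod using (_%_; n%n≡0; m<n⇒m%n≡m)
open import Data.Fin using (Fin; toℕ; fromℕ; fromℕ<; inject₁; _≟_) renaming (zero to fz; suc to fs)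
open import Data.Fin.Patterns using (0F; 1F; 2F)
open import Data.Fin.Properties
  using (toℕ-injective; toℕ-fromℕ<; toℕ-fromℕ; toℕ-inject₁; inject₁ℕ<; toℕ<n; fromℕ<-toℕ;
         pigeonhole; <⇒≢; injective⇒≤)
open import Data.Product using (Σ; ∃; _×_; _,_; proj₁; proj₂)
open import Data.Product.Properties using (≡-dec)
open import Data.Sum using (_⊎_; inj₁; inj₂; [_,_]′; swap)
open import Data.Empty using (⊥; ⊥-elim)
open import Data.Unit using (tt)
open import Data.List using (List; _∷_; length; lookup; map; filter; allFin)
open import Data.List.Properties using (length-map; length-tabulate; filter-notAll)
open import Data.List.Membership.Propositional using (_∈_; _∉_)
open import Data.List.Membership.Propositional.Properties using (∈-map⁺; ∈-filter⁺; ∈-allFin)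
open import Data.List.Relation.Unary.Any using (here; there; index)
import Data.List.Relation.Unary.Any as Any
open import Data.List.Relation.Unary.Any.Properties using (lookup-index)
import Data.List.Relation.Unary.All as All
open import Data.List.Relation.Unary.All.Properties using (map⁺; all-filter)
open import Function using (_∘_; id)
open import Function.Definitions using (Injective)
open import Relation.Nullary using (¬_; yes; no; ¬?)
open import Relation.Binary.Definitions using (DecidableEquality)
open import Relation.Binary.PropositionalEquality

data LastOrInject : {n : ℕ} → Fin (suc n) → Set where
  last   : ∀ {n} → LastOrInject (fromℕ n)
  inject : ∀ {n} (j : Fin n) → LastOrInject (inject₁ j)

lastOrInject : ∀ {n} (i : Fin (suc n)) → LastOrInject i
lastOrInject {zero}  fz     = last
lastOrInject {suc n} fz     = inject fz
lastOrInject {suc n} (fs i) with lastOrInject i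
... | last     = last
... | inject j = inject (fs j)

module _ {n : ℕ} where

  toℕ-csuc : (i : Fin (suc n)) → suc (toℕ i) < suc n → toℕ (csuc i) ≡ suc (toℕ i)
  toℕ-csuc i lt = trans (toℕ-fromℕ< _) (m<n⇒m%n≡m lt)

  csuc-inject₁ : (j : Fin n) → csuc (inject₁ j) ≡ fs j
  csuc-inject₁ j = toℕ-injective
    (trans (toℕ-csuc (inject₁ j) (s≤s (inject₁ℕ< j))) (cong suc (toℕ-inject₁ j)))

  csuc-fromℕ< : ∀ {m} (m<n : m < suc n) (1+m<n : suc m < suc n) →
                csuc (fromℕ< m<n) ≡ fromℕ< 1+m<n
  csuc-fromℕ< {m} m<n 1+m<n = toℕ-injective (begin
    toℕ (csuc (fromℕ< m<n))  ≡⟨ toℕ-csuc _ (subst (λ t → suc t < suc n) (sym (toℕ-fromℕ< m<n))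
                                                     1+m<n) ⟩
    suc (toℕ (fromℕ< m<n))   ≡⟨ cong suc (toℕ-fromℕ< m<n) ⟩
    suc m                    ≡⟨ sym (toℕ-fromℕ< 1+m<n) ⟩
    toℕ (fromℕ< 1+m<n)       ∎)
    where open ≡-Reasoning

  csuc-last : csuc (fromℕ n) ≡ fz
  csuc-last = toℕ-injective (trans (toℕ-fromℕ< _)
    (trans (cong (λ t → suc t % suc n) (toℕ-fromℕ n)) (n%n≡0 (suc n))))

  cpred : Fin (suc n) → Fin (suc n)
  cpred fz     = fromℕ n
  cpred (fs j) = inject₁ j

  csuc-cpred : (i : Fin (suc n)) → csuc (cpred i) ≡ i
  csuc-cpred fz     = csuc-last
  csuc-cpred (fs j) = csuc-inject₁ j

  cpred-csuc : (i : Fin (suc n)) → cpred (csuc i) ≡ i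
  cpred-csuc i with lastOrInject i
  ... | last     = cong cpred csuc-last
  ... | inject j = cong cpred (csuc-inject₁ j)

  csuc-injective : {i j : Fin (suc n)} → csuc i ≡ csuc j → i ≡ j
  csuc-injective {i} {j} e = trans (sym (cpred-csuc i)) (trans (cong cpred e) (cpred-csuc j))

  cpred-of : {i j : Fin (suc n)} → csuc j ≡ i → cpred i ≡ j
  cpred-of {j = j} e = trans (cong cpred (sym e)) (cpred-csuc j)

  -- a property of indices preserved and reflected by csuc holds everywhere
  -- or nowhere: the orbit of csuc is all of Fin (suc n)
  cycle-invariant : (Q : Fin (suc n) → Set) →
    (∀ i → Q i → Q (csuc i)) → (∀ i → Q (csuc i) → Q i) → ∀ i j → Q i → Q j
  cycle-invariant Q fwd bwd i j qi = to j (from i qi)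
    where
      reach : ∀ m (m<n : m < suc n) → (Q fz → Q (fromℕ< m<n)) × (Q (fromℕ< m<n) → Q fz)
      reach zero    _     = id , id
      reach (suc m) 1+m<n =
        (λ q → subst Q step (fwd _ (to′ q))) , (λ q → from′ (bwd _ (subst Q (sym step) q)))
        where
          m<n = <⇒≤ 1+m<n
          to′ = proj₁ (reach m m<n)
          from′ = proj₂ (reach m m<n)
          step = csuc-fromℕ< m<n 1+m<n
      to : ∀ j → Q fz → Q j
      to j = subst Q (fromℕ<-toℕ j (toℕ<n j)) ∘ proj₁ (reach (toℕ j) (toℕ<n j))
      from : ∀ i → Q i → Q fz
      from i = proj₂ (reach (toℕ i) (toℕ<n i)) ∘ subst Q (sym (fromℕ<-toℕ i (toℕ<n i)))

Beside : ∀ {n} → Fin (suc n) → Fin (suc n) → Set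
Beside p r = csuc p ≡ r ⊎ csuc r ≡ p

flanked : ∀ {n} {p r r′ : Fin (suc n)} → Beside p r → Beside p r′ → r ≢ r′ →
  (csuc p ≡ r ⊎ csuc p ≡ r′) × (cpred p ≡ r ⊎ cpred p ≡ r′)
flanked (inj₁ p→r) (inj₁ p→r′) r≢r′ = ⊥-elim (r≢r′ (trans (sym p→r) p→r′))
flanked (inj₁ p→r) (inj₂ r′→p) _    = inj₁ p→r , inj₂ (cpred-of r′→p)
flanked (inj₂ r→p) (inj₁ p→r′) _    = inj₂ p→r′ , inj₁ (cpred-of r→p)
flanked (inj₂ r→p) (inj₂ r′→p) r≢r′ = ⊥-elim (r≢r′ (csuc-injective (trans r→p (sym r′→p))))

-- With at least two indices csuc has no fixed point: otherwise the orbit {i}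
-- would be closed under csuc and hence contain both 0 and 1.
csuc≢ : ∀ {n} (i : Fin (suc (suc n))) → csuc i ≢ i
csuc≢ i csuc-i≡i = 0≢1 (trans (only-i fz) (sym (only-i (fs fz))))
  where
    only-i : ∀ j → j ≡ i
    only-i j = cycle-invariant (_≡ i) (λ _ e → trans (cong csuc e) csuc-i≡i)
      (λ _ e → csuc-injective (trans e (sym csuc-i≡i))) i j refl
    0≢1 : fz ≢ fs fz
    0≢1 ()

-- With at least three indices csuc has no 2-cycle: otherwise the orbit
-- {i, csuc i} would contain the three distinct indices 0, 1, 2.
csuc²≢ : ∀ {n} (i : Fin (suc (suc (suc n)))) → csuc (csuc i) ≢ i
csuc²≢ {n} i csuc²-i≡i = two-of-three (in-orbit fz) (in-orbit (fs fz)) (in-orbit (fs (fs fz)))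
  where
    Orbit : Fin (suc (suc (suc n))) → Set
    Orbit j = j ≡ i ⊎ j ≡ csuc i
    forward : ∀ j → Orbit j → Orbit (csuc j)
    forward _ (inj₁ refl) = inj₂ refl
    forward _ (inj₂ refl) = inj₁ csuc²-i≡i
    backward : ∀ j → Orbit (csuc j) → Orbit j
    backward _ (inj₁ e) = inj₂ (csuc-injective (trans e (sym csuc²-i≡i)))
    backward _ (inj₂ e) = inj₁ (csuc-injective e)
    in-orbit : ∀ j → Orbit j
    in-orbit j = cycle-invariant Orbit forward backward i j (inj₁ refl)
    0≢1 : fz ≢ fs fz
    0≢1 ()
    0≢2 : fz ≢ fs (fs fz)
    0≢2 ()
    1≢2 : fs fz ≢ fs (fs fz)
    1≢2 ()
    -- two of 0, 1, 2 would lie on the same side of the orbit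
    two-of-three : Orbit fz → Orbit (fs fz) → Orbit (fs (fs fz)) → ⊥
    two-of-three (inj₁ p) (inj₁ q) _        = 0≢1 (trans p (sym q))
    two-of-three (inj₂ p) (inj₂ q) _        = 0≢1 (trans p (sym q))
    two-of-three (inj₁ p) (inj₂ q) (inj₁ r) = 0≢2 (trans p (sym r))
    two-of-three (inj₂ p) (inj₁ q) (inj₂ r) = 0≢2 (trans p (sym r))
    two-of-three (inj₁ p) (inj₂ q) (inj₂ r) = 1≢2 (trans q (sym r))
    two-of-three (inj₂ p) (inj₁ q) (inj₁ r) = 1≢2 (trans q (sym r))

distinct-members-≤ : ∀ {A : Set} {m} {xs : List A} (w : Fin m → A) →
  Injective _≡_ _≡_ w → (∀ i → w i ∈ xs) → m ≤ length xs
distinct-members-≤ {xs = xs} w w-inj w∈xs = injective⇒≤ position-inj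
  where
    position-inj : Injective _≡_ _≡_ (λ i → index (w∈xs i))
    position-inj {i} {j} e = w-inj (begin
      w i                      ≡⟨ lookup-index (w∈xs i) ⟩
      lookup xs (index (w∈xs i)) ≡⟨ cong (lookup xs) e ⟩
      lookup xs (index (w∈xs j)) ≡⟨ sym (lookup-index (w∈xs j)) ⟩
      w j                      ∎)
      where open ≡-Reasoning

record CliqueCover {V : Set} (Adj : V → V → Set) (x : V) (r : ℕ) : Set₁ where
  field
    Part     : Fin r → V → Set
    classify : ∀ {v} → Adj x v → Σ (Fin r) λ p → Part p v
    clique   : ∀ {p u v} → Part p u → Part p v → u ≡ v ⊎ Adj u v

-- if every neighbourhood is covered by fewer than m cliques, two leaves of an
-- induced K_{1,m} would share a part: no induced K_{1,m} exists
no-induced-star : ∀ {V : Set} {Adj : V → V → Set} {r m} →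
  r < m → (∀ x → CliqueCover Adj x r) → ¬ InducedStar Adj m
no-induced-star r<m cover (x , leaf , leaf-inj , _ , centre-adj , independent)
  with pigeonhole r<m (λ t → proj₁ (classify (centre-adj t)))
  where open CliqueCover (cover x)
... | s , t , s<t , same-part =
  [ (λ e → <⇒≢ s<t (leaf-inj e)) , independent s t (<⇒≢ s<t) ]′
    (clique (proj₂ (classify (centre-adj s)))
            (subst (λ p → Part p (leaf t)) (sym same-part) (proj₂ (classify (centre-adj t)))))
  where open CliqueCover (cover x)

module OnCycle {V : Set} {Adj : V → V → Set} (adj-sym : ∀ {u v} → Adj u v → Adj v u)
  {q : ℕ} (f : Fin (suc (suc (suc q))) → V) (f-inj : Injective _≡_ _≡_ f)
  (f-step : ∀ p → Adj (f p) (f (csuc p))) where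

  next-to : ∀ r → Adj (f r) (f (csuc r)) × Adj (f r) (f (cpred r)) × f (csuc r) ≢ f (cpred r)
  next-to r = f-step r
            , adj-sym (subst (Adj (f (cpred r)) ∘ f) (csuc-cpred r) (f-step (cpred r)))
            , λ e → csuc²≢ r (trans (cong csuc (f-inj e)) (csuc-cpred r))

  degree-two : ∀ {r v x y} → f r ≡ v → (∀ {w} → Adj v w → w ≡ x ⊎ w ≡ y) →
    Σ (Fin (suc (suc (suc q)))) λ p → f p ≡ x × Beside p r
  degree-two {r} refl only-x-y with next-to r
  ... | to-next , to-prev , next≢prev with only-x-y to-next | only-x-y to-prev
  ... | inj₁ next≡x | _         = csuc r , next≡x , inj₂ refl
  ... | _         | inj₁ prev≡x = cpred r , prev≡x , inj₁ (csuc-cpred r)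
  ... | inj₂ next≡y | inj₂ prev≡y = ⊥-elim (next≢prev (trans next≡y (sym prev≡y)))

-- The neighbourhoods of G_k.  Each is listed as a union of cliques indexed
-- by Fin 3, which is what the claw-freeness argument needs.
module _ {n : ℕ} where
  private
    k = suc n

  adj-sym : ∀ u v → GAdj k u v → GAdj k v u
  adj-sym _ _ (inj₁ e) = inj₂ e
  adj-sym _ _ (inj₂ e) = inj₁ e

  data NbrA (i : Fin k) : Fin 3 → GV k → Set where
    b-same : NbrA i 0F (b , i)
    b-prev : ∀ {j} → csuc j ≡ i → NbrA i 1F (b , j)
    c-same : NbrA i 2F (c , i)
    c-prev : ∀ {j} → csuc j ≡ i → NbrA i 2F (c , j)

  data NbrB (i : Fin k) : Fin 3 → GV k → Set where
    a-same : NbrB i 0F (a , i)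
    a-next : NbrB i 1F (a , csuc i)

  data NbrC (i : Fin k) : Fin 3 → GV k → Set where
    a-same : NbrC i 0F (a , i)
    c-prev : ∀ {j} → csuc j ≡ i → NbrC i 0F (c , j)
    a-next : NbrC i 1F (a , csuc i)
    c-next : NbrC i 1F (c , csuc i)

  nbrA : ∀ {i v} → GAdj k (a , i) v → Σ (Fin 3) λ p → NbrA i p v
  nbrA {v = b , _} (inj₁ (inj₁ refl)) = _ , b-same
  nbrA {v = b , _} (inj₁ (inj₂ e))    = _ , b-prev e
  nbrA {v = c , _} (inj₁ (inj₁ refl)) = _ , c-same
  nbrA {v = c , _} (inj₁ (inj₂ e))    = _ , c-prev e
  nbrA {v = a , _} (inj₁ ())
  nbrA {v = a , _} (inj₂ ())
  nbrA {v = b , _} (inj₂ ())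
  nbrA {v = c , _} (inj₂ ())

  nbrB : ∀ {i v} → GAdj k (b , i) v → Σ (Fin 3) λ p → NbrB i p v
  nbrB {v = a , _} (inj₂ (inj₁ refl)) = _ , a-same
  nbrB {v = a , _} (inj₂ (inj₂ refl)) = _ , a-next
  nbrB {v = a , _} (inj₁ ())
  nbrB {v = b , _} (inj₁ ())
  nbrB {v = b , _} (inj₂ ())
  nbrB {v = c , _} (inj₁ ())
  nbrB {v = c , _} (inj₂ ())

  nbrC : ∀ {i v} → GAdj k (c , i) v → Σ (Fin 3) λ p → NbrC i p v
  nbrC {v = a , _} (inj₂ (inj₁ refl)) = _ , a-same
  nbrC {v = a , _} (inj₂ (inj₂ refl)) = _ , a-next
  nbrC {v = c , _} (inj₁ refl)        = _ , c-next
  nbrC {v = c , _} (inj₂ e)           = _ , c-prev (sym e)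
  nbrC {v = a , _} (inj₁ ())
  nbrC {v = b , _} (inj₁ ())
  nbrC {v = b , _} (inj₂ ())

  b-nbr-kind : ∀ {v w} → proj₁ v ≡ b → GAdj k v w → proj₁ w ≡ a
  b-nbr-kind {b , _} refl adj with nbrB adj
  ... | _ , a-same = refl
  ... | _ , a-next = refl

  c-nbr-kind : ∀ {v w} → proj₁ v ≡ c → GAdj k v w → proj₁ w ≡ a ⊎ proj₁ w ≡ c
  c-nbr-kind {c , _} refl adj with nbrC adj
  ... | _ , a-same   = inj₁ refl
  ... | _ , c-prev _ = inj₂ refl
  ... | _ , a-next   = inj₁ refl
  ... | _ , c-next   = inj₂ refl

  clique-cover : ∀ v → CliqueCover (GAdj k) v 3
  clique-cover (a , i) = record { Part = NbrA i ; classify = nbrA ; clique = clique }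
    where
      clique : ∀ {p u v} → NbrA i p u → NbrA i p v → u ≡ v ⊎ GAdj k u v
      clique b-same     b-same      = inj₁ refl
      clique (b-prev e) (b-prev e′) = inj₁ (cong (b ,_) (csuc-injective (trans e (sym e′))))
      clique c-same     c-same      = inj₁ refl
      clique c-same     (c-prev e)  = inj₂ (inj₂ (sym e))
      clique (c-prev e) c-same      = inj₂ (inj₁ (sym e))
      clique (c-prev e) (c-prev e′) = inj₁ (cong (c ,_) (csuc-injective (trans e (sym e′))))
  clique-cover (b , i) = record { Part = NbrB i ; classify = nbrB ; clique = clique }
    where
      clique : ∀ {p u v} → NbrB i p u → NbrB i p v → u ≡ v ⊎ GAdj k u v
      clique a-same a-same = inj₁ refl
      clique a-next a-next = inj₁ refl
  clique-cover (c , i) = record { Part = NbrC i ; classify = nbrC ; clique = clique }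
    where
      clique : ∀ {p u v} → NbrC i p u → NbrC i p v → u ≡ v ⊎ GAdj k u v
      clique a-same     a-same      = inj₁ refl
      clique a-same     (c-prev e)  = inj₂ (inj₁ (inj₂ e))
      clique (c-prev e) a-same      = inj₂ (inj₂ (inj₂ e))
      clique (c-prev e) (c-prev e′) = inj₁ (cong (c ,_) (csuc-injective (trans e (sym e′))))
      clique a-next     a-next      = inj₁ refl
      clique a-next     c-next      = inj₂ (inj₁ (inj₁ refl))
      clique c-next     a-next      = inj₂ (inj₂ (inj₁ refl))
      clique c-next     c-next      = inj₁ refl

  K₁₄-free : ¬ InducedStar (GAdj k) 4
  K₁₄-free = no-induced-star (n<1+n 3) clique-cover

-- b_{i+1}, b_i, c_{i+1} are pairwise non-adjacent neighbours of a_{i+1};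
-- we take i = 0 (they are distinct as soon as k ≥ 2)
claw : ∀ {n} → InducedStar (GAdj (suc (suc n))) 3
claw {n} = (a , csuc fz) , leaf , leaf-inj , leaf≢centre , centre-adj , independent
  where
    leaf : Fin 3 → GV (suc (suc n))
    leaf 0F = (b , csuc fz)
    leaf 1F = (b , fz)
    leaf 2F = (c , csuc fz)

    leaf-not-a : ∀ t → proj₁ (leaf t) ≢ a
    leaf-not-a 0F ()
    leaf-not-a 1F ()
    leaf-not-a 2F ()

    leaf-inj : Injective _≡_ _≡_ leaf
    leaf-inj {0F} {0F} _ = refl
    leaf-inj {1F} {1F} _ = refl
    leaf-inj {2F} {2F} _ = refl
    leaf-inj {0F} {1F} e = ⊥-elim (csuc≢ fz (cong proj₂ e))
    leaf-inj {1F} {0F} e = ⊥-elim (csuc≢ fz (cong proj₂ (sym e)))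
    leaf-inj {0F} {2F} ()
    leaf-inj {1F} {2F} ()
    leaf-inj {2F} {0F} ()
    leaf-inj {2F} {1F} ()

    leaf≢centre : ∀ t → leaf t ≢ (a , csuc fz)
    leaf≢centre t e = leaf-not-a t (cong proj₁ e)

    centre-adj : ∀ t → GAdj (suc (suc n)) (a , csuc fz) (leaf t)
    centre-adj 0F = inj₁ (inj₁ refl)
    centre-adj 1F = inj₁ (inj₂ refl)
    centre-adj 2F = inj₁ (inj₁ refl)

    -- every pair of leaves contains a b-vertex, whose neighbours are a-vertices
    b-leaf : ∀ t t′ → proj₁ (leaf t) ≡ b → ¬ GAdj (suc (suc n)) (leaf t) (leaf t′)
    b-leaf t t′ is-b adj = leaf-not-a t′ (b-nbr-kind {suc n} {leaf t} {leaf t′} is-b adj)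

    independent : ∀ t t′ → t ≢ t′ → ¬ GAdj (suc (suc n)) (leaf t) (leaf t′)
    independent 0F t′ _  = b-leaf 0F t′ refl
    independent 1F t′ _  = b-leaf 1F t′ refl
    independent 2F 0F _  = b-leaf 0F 2F refl ∘ adj-sym (leaf 2F) (leaf 0F)
    independent 2F 1F _  = b-leaf 1F 2F refl ∘ adj-sym (leaf 2F) (leaf 1F)
    independent 2F 2F ne = ⊥-elim (ne refl)

_≟-kind_ : DecidableEquality Kind
a ≟-kind a = yes refl
b ≟-kind b = yes refl
c ≟-kind c = yes refl
a ≟-kind b = no λ ()
a ≟-kind c = no λ ()
b ≟-kind a = no λ ()
b ≟-kind c = no λ ()
c ≟-kind a = no λ ()
c ≟-kind b = no λ ()

module LowerBound {n : ℕ} (D : List (GV (suc n))) (D-dom : Dominates (GAdj (suc n)) AllV D) where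
  private
    k = suc n

  open import Data.List.Membership.DecPropositional (≡-dec _≟-kind_ (_≟_ {k})) using (_∈?_)

  dominated : ∀ {u} → u ∉ D → (∀ {w} → GAdj k u w → w ∉ D) → ⊥
  dominated {u} u∉D nbrs∉D with proj₂ D-dom u tt u∉D
  ... | _ , w∈D , u~w = nbrs∉D u~w w∈D

  b-dominated : ∀ {j} → (b , j) ∉ D → (a , j) ∉ D → (a , csuc j) ∉ D → ⊥
  b-dominated {j} b∉D a∉D a′∉D = dominated b∉D (nbr∉D ∘ nbrB)
    where nbr∉D : ∀ {w} → Σ (Fin 3) (λ p → NbrB j p w) → w ∉ D
          nbr∉D (_ , a-same) = a∉D
          nbr∉D (_ , a-next) = a′∉D

  c-dominated : ∀ {j} → (c , j) ∉ D → (a , j) ∉ D → (a , csuc j) ∉ D →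
                (c , csuc j) ∉ D → (c , cpred j) ∉ D → ⊥
  c-dominated {j} c∉D a∉D a′∉D c′∉D c″∉D = dominated c∉D (nbr∉D ∘ nbrC)
    where nbr∉D : ∀ {w} → Σ (Fin 3) (λ p → NbrC j p w) → w ∉ D
          nbr∉D (_ , a-same)   = a∉D
          nbr∉D (_ , a-next)   = a′∉D
          nbr∉D (_ , c-next)   = c′∉D
          nbr∉D (_ , c-prev e) = subst (λ j → (c , j) ∉ D) (cpred-of e) c″∉D

  -- Witness i v: v ∈ D is the vertex charged to index i, namely the first of
  -- a_i, c_{i-1}, b_i, c_i, b_{i-1} lying in D; each constructor records the
  -- absences that the uniqueness argument uses.
  data Witness (i : Fin k) : GV k → Set where
    at-a      : Witness i (a , i)
    at-c-prev : ∀ {j} → csuc j ≡ i → (a , i) ∉ D → Witness i (c , j)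
    at-b      : (a , i) ∉ D → (c , cpred i) ∉ D → Witness i (b , i)
    at-c      : (a , i) ∉ D → (b , i) ∉ D → Witness i (c , i)
    at-b-prev : ∀ {j} → csuc j ≡ i → (a , i) ∉ D → (c , i) ∉ D → (c , j) ∉ D →
                Witness i (b , j)

  -- a_i is dominated, so one of the five candidates lies in D
  witness : ∀ i → Σ (GV k) λ v → v ∈ D × Witness i v
  witness i with (a , i) ∈? D
  ... | yes a∈D = _ , a∈D , at-a
  ... | no a∉D with (c , cpred i) ∈? D
  ... | yes c′∈D = _ , c′∈D , at-c-prev (csuc-cpred i) a∉D
  ... | no c′∉D with (b , i) ∈? D
  ... | yes b∈D = _ , b∈D , at-b a∉D c′∉D
  ... | no b∉D with (c , i) ∈? D
  ... | yes c∈D = _ , c∈D , at-c a∉D b∉D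
  ... | no c∉D with (b , cpred i) ∈? D
  ... | yes b′∈D = _ , b′∈D , at-b-prev (csuc-cpred i) a∉D c∉D c′∉D
  ... | no b′∉D = ⊥-elim (dominated a∉D (nbr∉D ∘ nbrA))
    where nbr∉D : ∀ {w} → Σ (Fin 3) (λ p → NbrA i p w) → w ∉ D
          nbr∉D (_ , b-same)   = b∉D
          nbr∉D (_ , b-prev e) = subst (λ j → (b , j) ∉ D) (cpred-of e) b′∉D
          nbr∉D (_ , c-same)   = c∉D
          nbr∉D (_ , c-prev e) = subst (λ j → (c , j) ∉ D) (cpred-of e) c′∉D

  -- c_j charged both as c_{i-1} (csuc j ≡ i) and as c_j leaves b_j undominated
  c-b-collision : ∀ {i j} → csuc j ≡ i → (a , i) ∉ D → (a , j) ∉ D → (b , j) ∉ D → ⊥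
  c-b-collision refl a′∉D a∉D b∉D = b-dominated b∉D a∉D a′∉D

  -- b_i charged both as b_i and as b_{j-1} (csuc i ≡ j) leaves c_i undominated
  b-c-collision : ∀ {i j} → csuc i ≡ j → (a , i) ∉ D → (c , cpred i) ∉ D →
                  (a , j) ∉ D → (c , j) ∉ D → (c , i) ∉ D → ⊥
  b-c-collision refl a∉D c′∉D a″∉D c″∉D c∉D = c-dominated c∉D a∉D a″∉D c″∉D c′∉D

  witness-unique : ∀ {i j v} → Witness i v → Witness j v → i ≡ j
  witness-unique at-a                 at-a                  = refl
  witness-unique (at-b _ _)           (at-b _ _)            = refl
  witness-unique (at-c _ _)           (at-c _ _)            = refl
  witness-unique (at-c-prev e _)      (at-c-prev e′ _)      = trans (sym e) e′
  witness-unique (at-b-prev e _ _ _)  (at-b-prev e′ _ _ _)  = trans (sym e) e′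
  witness-unique (at-c-prev e a∉D)    (at-c a′∉D b∉D)       =
    ⊥-elim (c-b-collision e a∉D a′∉D b∉D)
  witness-unique (at-c a′∉D b∉D)      (at-c-prev e a∉D)     =
    ⊥-elim (c-b-collision e a∉D a′∉D b∉D)
  witness-unique (at-b a∉D c′∉D)      (at-b-prev e a″∉D c″∉D c∉D) =
    ⊥-elim (b-c-collision e a∉D c′∉D a″∉D c″∉D c∉D)
  witness-unique (at-b-prev e a″∉D c″∉D c∉D) (at-b a∉D c′∉D) =
    ⊥-elim (b-c-collision e a∉D c′∉D a″∉D c″∉D c∉D)

  dominating-≥ : k ≤ length D
  dominating-≥ = distinct-members-≤ (proj₁ ∘ witness) charged-inj (proj₁ ∘ proj₂ ∘ witness)
    where
      charged-inj : Injective _≡_ _≡_ (proj₁ ∘ witness)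
      charged-inj {i} {j} e =
        witness-unique (subst (Witness i) e (proj₂ (proj₂ (witness i)))) (proj₂ (proj₂ (witness j)))

module _ {n : ℕ} where
  private
    k = suc n

  a-vertices : List (Fin k) → List (GV k)
  a-vertices = map (a ,_)

  without : Fin k → List (Fin k) → List (Fin k)
  without i = filter (λ j → ¬? (j ≟ i))

  ∈-without : ∀ {i j J} → j ∈ J → j ≢ i → j ∈ without i J
  ∈-without {i} = ∈-filter⁺ (λ j → ¬? (j ≟ i))

  without-shorter : ∀ {i J} → i ∈ J → length (without i J) < length J
  without-shorter {i} {J} i∈J =
    filter-notAll (λ j → ¬? (j ≟ i)) J (Any.map (λ i≡j j≢i → j≢i (sym i≡j)) i∈J)

  others : Fin k → List (Fin k)
  others i = without i (allFin k)

  others₂ : Fin k → List (Fin k)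
  others₂ i = without (csuc i) (others i)

  others-shorter : ∀ i → length (others i) < k
  others-shorter i = subst (length (others i) <_) (length-tabulate id) (without-shorter (∈-allFin i))

  rim-adj : ∀ s j → s ≢ a → GAdj k (s , j) (a , j) × GAdj k (s , j) (a , csuc j)
  rim-adj a _ s≢a = ⊥-elim (s≢a refl)
  rim-adj b _ _   = inj₂ (inj₁ refl) , inj₂ (inj₂ refl)
  rim-adj c _ _   = inj₂ (inj₁ refl) , inj₂ (inj₂ refl)

  rim-dominated : ∀ {J} s j → s ≢ a → j ∈ J ⊎ csuc j ∈ J →
                  ∃ λ w → w ∈ a-vertices J × GAdj k (s , j) w
  rim-dominated s j s≢a (inj₁ j∈J)  = _ , ∈-map⁺ (a ,_) j∈J  , proj₁ (rim-adj s j s≢a)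
  rim-dominated s j s≢a (inj₂ j′∈J) = _ , ∈-map⁺ (a ,_) j′∈J , proj₂ (rim-adj s j s≢a)

  a-vertices-avoid : ∀ J {v} → proj₁ v ≢ a → All.All (_≢ v) (a-vertices J)
  a-vertices-avoid J v≢a = map⁺ (All.universal (λ _ e → v≢a (sym (cong proj₁ e))) J)

  all-a-dominates : Dominates (GAdj k) AllV (a-vertices (allFin k))
  all-a-dominates = All.universal (λ _ → tt) _ , dominate
    where
      dominate : ∀ u → AllV u → u ∉ a-vertices (allFin k) →
                 ∃ λ w → w ∈ a-vertices (allFin k) × GAdj k u w
      dominate (a , j) _ a∉ = ⊥-elim (a∉ (∈-map⁺ (a ,_) (∈-allFin j)))
      dominate (b , j) _ _  = rim-dominated b j (λ ()) (inj₁ (∈-allFin j))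
      dominate (c , j) _ _  = rim-dominated c j (λ ()) (inj₁ (∈-allFin j))

  all-a-length : length (a-vertices (allFin k)) ≡ k
  all-a-length = trans (length-map {B = GV k} (a ,_) (allFin k)) (length-tabulate id)

module _ {n : ℕ} where
  private
    k = suc (suc n)

  drop-a-dominates : ∀ i → Dominates (GAdj k) (_≢ (a , i)) (a-vertices (others i))
  drop-a-dominates i =
    map⁺ (All.map (λ j≢i e → j≢i (cong proj₂ e)) (all-filter (λ j → ¬? (j ≟ i)) (allFin k))) ,
    dominate
    where
      -- b_i and c_i use a_{i+1}, every other rim vertex its own a-vertex
      index-present : ∀ j → j ∈ others i ⊎ csuc j ∈ others i
      index-present j with j ≟ i
      ... | yes refl = inj₂ (∈-without (∈-allFin (csuc j)) (csuc≢ j))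
      ... | no j≢i   = inj₁ (∈-without (∈-allFin j) j≢i)
      dominate : ∀ u → u ≢ (a , i) → u ∉ a-vertices (others i) →
                 ∃ λ w → w ∈ a-vertices (others i) × GAdj k u w
      dominate (a , j) u≢a u∉ with j ≟ i
      ... | yes refl = ⊥-elim (u≢a refl)
      ... | no j≢i   = ⊥-elim (u∉ (∈-map⁺ (a ,_) (∈-without (∈-allFin j) j≢i)))
      dominate (b , j) _ _ = rim-dominated b j (λ ()) (index-present j)
      dominate (c , j) _ _ = rim-dominated c j (λ ()) (index-present j)

  drop-a-length : ∀ i → length (a-vertices (others i)) < k
  drop-a-length i = subst (_< k) (sym (length-map {B = GV k} (a ,_) (others i))) (others-shorter i)

module _ {n : ℕ} where
  private
    k = suc (suc (suc n))

  ∈-others₂ : ∀ {i j : Fin k} → j ≢ i → j ≢ csuc i → j ∈ others₂ i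
  ∈-others₂ {j = j} j≢i j≢i′ = ∈-without (∈-without (∈-allFin j) j≢i) j≢i′

  -- a rim vertex (s, j) with j ≢ i is dominated via a_j, or via a_{i+2} when j = i+1
  rim-covered : ∀ i (x : GV k) s j → s ≢ a → j ≢ i →
                ∃ λ w → w ∈ x ∷ a-vertices (others₂ i) × GAdj k (s , j) w
  rim-covered i x s j s≢a j≢i with rim-dominated s j s≢a (index-present j j≢i)
    where
      index-present : ∀ j → j ≢ i → j ∈ others₂ i ⊎ csuc j ∈ others₂ i
      index-present j j≢i with j ≟ csuc i
      ... | yes refl = inj₂ (∈-others₂ (csuc²≢ i) (csuc≢ (csuc i)))
      ... | no j≢i′  = inj₁ (∈-others₂ j≢i j≢i′)
  ... | w , w∈ , adj = w , there w∈ , adj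

  a-covered : ∀ i x j → GAdj k (a , i) x → GAdj k (a , csuc i) x →
              (a , j) ∉ x ∷ a-vertices (others₂ i) →
              ∃ λ w → w ∈ x ∷ a-vertices (others₂ i) × GAdj k (a , j) w
  a-covered i x j x~aᵢ x~aᵢ₊₁ a∉ with j ≟ i | j ≟ csuc i
  ... | yes refl | _        = x , here refl , x~aᵢ
  ... | no _     | yes refl = x , here refl , x~aᵢ₊₁
  ... | no j≢i   | no j≢i′  = ⊥-elim (a∉ (there (∈-map⁺ (a ,_) (∈-others₂ j≢i j≢i′))))

  drop-b-dominates : ∀ i → Dominates (GAdj k) (_≢ (b , i)) ((c , i) ∷ a-vertices (others₂ i))
  drop-b-dominates i = (λ ()) All.∷ a-vertices-avoid (others₂ i) (λ ()) , dominate
    where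
      dominate : ∀ u → u ≢ (b , i) → u ∉ (c , i) ∷ a-vertices (others₂ i) →
                 ∃ λ w → w ∈ (c , i) ∷ a-vertices (others₂ i) × GAdj k u w
      dominate (a , j) _ a∉ = a-covered i (c , i) j (inj₁ (inj₁ refl)) (inj₁ (inj₂ refl)) a∉
      dominate (b , j) b≢ _ with j ≟ i
      ... | yes refl = ⊥-elim (b≢ refl)
      ... | no j≢i   = rim-covered i (c , i) b j (λ ()) j≢i
      dominate (c , j) _ c∉ with j ≟ i
      ... | yes refl = ⊥-elim (c∉ (here refl))
      ... | no j≢i   = rim-covered i (c , i) c j (λ ()) j≢i

  drop-c-dominates : ∀ i → Dominates (GAdj k) (_≢ (c , i)) ((b , i) ∷ a-vertices (others₂ i))
  drop-c-dominates i = (λ ()) All.∷ a-vertices-avoid (others₂ i) (λ ()) , dominate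
    where
      dominate : ∀ u → u ≢ (c , i) → u ∉ (b , i) ∷ a-vertices (others₂ i) →
                 ∃ λ w → w ∈ (b , i) ∷ a-vertices (others₂ i) × GAdj k u w
      dominate (a , j) _ a∉ = a-covered i (b , i) j (inj₁ (inj₁ refl)) (inj₁ (inj₂ refl)) a∉
      dominate (b , j) _ b∉ with j ≟ i
      ... | yes refl = ⊥-elim (b∉ (here refl))
      ... | no j≢i   = rim-covered i (b , i) b j (λ ()) j≢i
      dominate (c , j) c≢ _ with j ≟ i
      ... | yes refl = ⊥-elim (c≢ refl)
      ... | no j≢i   = rim-covered i (b , i) c j (λ ()) j≢i

  drop-rim-length : ∀ i (x : GV k) → length (x ∷ a-vertices (others₂ i)) < k
  drop-rim-length i x = subst (λ l → suc l < k) (sym (length-map {B = GV k} (a ,_) (others₂ i)))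
    (≤-trans (s≤s (without-shorter (∈-without (∈-allFin (csuc i)) (csuc≢ i)))) (others-shorter i))

  vertex-critical : VertexCritical (GAdj k) k
  vertex-critical =
    ((a-vertices (allFin k) , all-a-dominates , all-a-length) , LowerBound.dominating-≥) , drop
    where
      drop : ∀ v → DomNumberBelow (GAdj k) (_≢ v) k
      drop (a , i) = _ , drop-a-dominates i , drop-a-length i
      drop (b , i) = _ , drop-b-dominates i , drop-rim-length i (c , i)
      drop (c , i) = _ , drop-c-dominates i , drop-rim-length i (b , i)

module NonHamiltonian {n q : ℕ} (f : Fin (suc (suc (suc q))) → GV (suc (suc n)))
  (f-inj : Injective _≡_ _≡_ f) (f-onto : ∀ v → ∃ λ p → f p ≡ v)
  (f-step : ∀ p → GAdj (suc (suc n)) (f p) (f (csuc p))) where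
  private
    k = suc (suc n)

  open OnCycle (λ {u} {v} → adj-sym u v) f f-inj f-step

  b-nbrs : ∀ {j w} → GAdj k (b , j) w → w ≡ (a , j) ⊎ w ≡ (a , csuc j)
  b-nbrs adj with nbrB adj
  ... | _ , a-same = inj₁ refl
  ... | _ , a-next = inj₂ refl

  -- a vertex occupies only one position
  located : ∀ {p r x} → f p ≡ x → (Σ (Fin (suc (suc (suc q)))) λ p′ → f p′ ≡ x × Beside p′ r) → Beside p r
  located at-p (_ , at-p′ , beside) = subst (λ x → Beside x _) (f-inj (trans at-p′ (sym at-p))) beside

  -- b_j has degree two, so it sits next to both a_j and a_{j+1} on the cycle
  b-beside-a : ∀ {p r i j} → f p ≡ (a , i) → f r ≡ (b , j) → i ≡ j ⊎ i ≡ csuc j → Beside p r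
  b-beside-a at-p at-r (inj₁ refl) = located at-p (degree-two at-r b-nbrs)
  b-beside-a at-p at-r (inj₂ refl) = located at-p (degree-two at-r (swap ∘ b-nbrs))

  a-between-bs : ∀ p → proj₁ (f p) ≡ a → proj₁ (f (csuc p)) ≡ b × proj₁ (f (cpred p)) ≡ b
  a-between-bs p is-a with f-onto (b , proj₂ (f p)) | f-onto (b , cpred (proj₂ (f p)))
  ... | r , at-r | r′ , at-r′ =
    [ b-at , b-at′ ]′ (proj₁ flanks) , [ b-at , b-at′ ]′ (proj₂ flanks)
    where
      i = proj₂ (f p)
      at-p : f p ≡ (a , i)
      at-p = cong (_, i) is-a
      r≢r′ : r ≢ r′
      r≢r′ e = csuc≢ i (trans (cong csuc (cong proj₂ (trans (sym at-r) (trans (cong f e) at-r′))))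
                             (csuc-cpred i))
      flanks = flanked (b-beside-a at-p at-r (inj₁ refl))
                       (b-beside-a at-p at-r′ (inj₂ (sym (csuc-cpred i)))) r≢r′
      b-at : ∀ {x} → x ≡ r → proj₁ (f x) ≡ b
      b-at refl = cong proj₁ at-r
      b-at′ : ∀ {x} → x ≡ r′ → proj₁ (f x) ≡ b
      b-at′ refl = cong proj₁ at-r′

  -- hence no a-vertex is next to a c-vertex, and since c-vertices have only
  -- a- and c-neighbours, the positions holding c-vertices are closed under
  -- the cyclic successor and predecessor
  c≢b : c ≢ b
  c≢b ()

  c-forward : ∀ p → proj₁ (f p) ≡ c → proj₁ (f (csuc p)) ≡ c
  c-forward p is-c with c-nbr-kind is-c (f-step p)
  ... | inj₂ next-c = next-c
  ... | inj₁ next-a = ⊥-elim (c≢b (trans (sym is-c) p-is-b))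
    where
      p-is-b : proj₁ (f p) ≡ b
      p-is-b = subst (λ x → proj₁ (f x) ≡ b) (cpred-csuc p) (proj₂ (a-between-bs (csuc p) next-a))

  c-backward : ∀ p → proj₁ (f (csuc p)) ≡ c → proj₁ (f p) ≡ c
  c-backward p is-c with c-nbr-kind is-c (adj-sym (f p) (f (csuc p)) (f-step p))
  ... | inj₂ prev-c = prev-c
  ... | inj₁ prev-a = ⊥-elim (c≢b (trans (sym is-c) (proj₁ (a-between-bs p prev-a))))

  -- then the position of c_0 forces a c-vertex at the position of b_0
  contradiction : ⊥
  contradiction with f-onto (c , fz) | f-onto (b , fz)
  ... | t , at-t | t′ , at-t′ =
    c≢b (trans (sym (cycle-invariant IsC c-forward c-backward t t′ (cong proj₁ at-t)))
               (cong proj₁ at-t′))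
    where IsC : Fin (suc (suc (suc q))) → Set
          IsC p = proj₁ (f p) ≡ c

not-hamiltonian : ∀ {n} → ¬ Hamiltonian (GAdj (suc (suc n)))
not-hamiltonian (_ , f , s≤s (s≤s (s≤s _)) , f-inj , f-onto , f-step) =
  NonHamiltonian.contradiction f f-inj f-onto f-step

lemma2p8 : (k : ℕ) → 3 ≤ k →
    VertexCritical (GAdj k) k
    × ¬ InducedStar (GAdj k) 4
    × InducedStar (GAdj k) 3
    × ¬ Hamiltonian (GAdj k)
lemma2p8 (suc (suc (suc m))) _ = vertex-critical , K₁₄-free , claw , not-hamiltonian
lemma2p8 (suc (suc zero)) (s≤s (s≤s ()))
lemma2p8 (suc zero)       (s≤s ())
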